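{- Let $d\ge 1$, let $P\subset\mathbb{R}^d$ be the $d$-dimensional cross-polytope, and let $T_P$ be a triangulation of $P$ whose restriction to $\partial P$ is antipodally symmetric, equipped with a Tucker labeling $\ell$. Define the time-$1$ deformation $\Delta_{T_P}(1,\cdot):P\to P$ by $\Delta_{T_P}(1,v)=e_{\ell(v)}$ for every vertex $v$ of $T_P$, extended linearly over each simplex of $T_P$, and let $$S_{T_P}(1)=\sum_{\sigma} \operatorname{vol}\big(\Delta_{T_P}(1,\sigma)\big),$$ the sum over all $d$-dimensional simplices $\sigma$ of $T_P$ of the signed volumes of their images. If $S_{T_P}(1)\neq 0$, then $T_P$ contains a complementary edge.
   Context: $e_i$ denotes the $i$-th standard unit basis vector of $\mathbb{R}^d$ and $e_{ -i}=-e_i$. The cross-polytope $P$ is the convex hull of $\{e_i,e_{ -i}\}_{i=1}^d$. A triangulation is a subdivision into simplices meeting face-to-face or not at all; its restriction to $\partial P$ is antipodally symmetric if $\sigma$ a simplex in $\partial P$ implies $-\sigma$ is a simplex. A Tucker labeling assigns to each vertex $v$ a label $\ell(v)\in\{\pm1,\dots,\pm d\}$ such that antipodal vertices $v,-v$ in $\partial P$ have labels summing to zero, i.e. $\ell(-v)=-\ell(v)$. A complementary edge is a pair of adjacent vertices of $T_P$ whose labels sum to zero. Signed volume: for a $d$-simplex $\sigma$ with vertices $v_0,\dots,v_d$ ordered so that $\det[v_1-v_0,\dots,v_d-v_0]\ge 0$, the signed volume of its image is $\frac{1}{d!}\det[w_1-w_0,\dots,w_d-w_0]$ where $w_j=\Delta_{T_P}(1,v_j)$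 (same ordering of vertices). -}

module Defs where

open import Level using (Level) renaming (suc to lsuc)
open import Data.Nat as ℕ using (ℕ; zero; suc)
open import Data.Nat using (_!)
open import Data.Fin using (Fin; zero; suc; punchIn; splitAt)
open import Data.Vec using (Vec; lookup; tabulate)
open import Data.Bool using (Bool; true; false)
open import Data.Product using (Σ; ∃; _×_; _,_)
open import Data.Sum using (_⊎_; inj₁; inj₂)
open import Relation.Binary.PropositionalEquality using (_≡_; _≢_)
open import Relation.Nullary using (¬_)
open import Data.Unit using (⊤)

-- The real numbers, axiomatised as a complete ordered field
-- (any two such are isomorphic, so quantifying over them = working in ℝ).

record CompleteOrderedField : Set₁ where
  infixl 6 _+_ _-_
  infixl 7 _*_
  infix 4 _≤_ _<_
  field
    Carrier : Set
    0# 1# : Carrier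
    _+_ _*_ : Carrier → Carrier → Carrier
    -_ : Carrier → Carrier
    _⁻¹ : Carrier → Carrier
    _≤_ : Carrier → Carrier → Set
    +-assoc : ∀ x y z → (x + y) + z ≡ x + (y + z)
    +-comm : ∀ x y → x + y ≡ y + x
    +-identityˡ : ∀ x → 0# + x ≡ x
    +-inverseˡ : ∀ x → (- x) + x ≡ 0#
    *-assoc : ∀ x y z → (x * y) * z ≡ x * (y * z)
    *-comm : ∀ x y → x * y ≡ y * x
    *-identityˡ : ∀ x → 1# * x ≡ x
    distribˡ : ∀ x y z → x * (y + z) ≡ x * y + x * z
    0≢1 : 0# ≢ 1#
    *-inverseʳ : ∀ x → x ≢ 0# → x * (x ⁻¹) ≡ 1#
    ≤-refl : ∀ x → x ≤ x
    ≤-trans : ∀ {x y z} → x ≤ y → y ≤ z → x ≤ z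
    ≤-antisym : ∀ {x y} → x ≤ y → y ≤ x → x ≡ y
    ≤-total : ∀ x y → x ≤ y ⊎ y ≤ x
    +-mono-≤ : ∀ {x y} z → x ≤ y → x + z ≤ y + z
    *-nonneg : ∀ {x y} → 0# ≤ x → 0# ≤ y → 0# ≤ x * y
    sup : (S : Carrier → Set) → (∃ λ x → S x) → (∃ λ b → ∀ x → S x → x ≤ b) →
          ∃ λ s → (∀ x → S x → x ≤ s) × (∀ b → (∀ x → S x → x ≤ b) → s ≤ b)

  _-_ : Carrier → Carrier → Carrier
  x - y = x + (- y)

  _<_ : Carrier → Carrier → Set
  x < y = (x ≤ y) × (x ≢ y)

  fromℕ : ℕ → Carrier
  fromℕ zero = 0#
  fromℕ (suc n) = 1# + fromℕ n

  ∑ : ∀ n → (Fin n → Carrier) → Carrier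
  ∑ zero f = 0#
  ∑ (suc n) f = f zero + ∑ n (λ i → f (suc i))

  altSign : ℕ → Carrier
  altSign zero = 1#
  altSign (suc n) = - altSign n

  toℕ' : ∀ {n} → Fin n → ℕ
  toℕ' zero = zero
  toℕ' (suc i) = suc (toℕ' i)

  det : ∀ n → (Fin n → Fin n → Carrier) → Carrier
  det zero M = 1#
  det (suc n) M = ∑ (suc n) λ j →
    altSign (toℕ' j) * M zero j * det n (λ r c → M (suc r) (punchIn j c))

module Geometry (F : CompleteOrderedField) (d : ℕ) where
  open CompleteOrderedField F

  Point : Set
  Point = Vec Carrier d

  neg : Point → Point
  neg v = tabulate λ c → - lookup v c

  InConv : ∀ {k} → (Fin k → Point) → (Fin k → Set) → Point → Set
  InConv {k} vs S x = Σ (Fin k → Carrier) λ λs →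
      (∀ i → 0# ≤ λs i)
    × (∀ i → λs i ≢ 0# → S i)
    × (∑ k λs ≡ 1#)
    × (∀ c → lookup x c ≡ ∑ k (λ i → λs i * lookup (vs i) c))

  All : ∀ {k} → Fin k → Set
  All _ = ⊤

  -- Labels ±1,…,±d : (index, sign) with true = + and false = −
  Label : Set
  Label = Fin d × Bool

  negL : Label → Label
  negL (i , true) = i , false
  negL (i , false) = i , true

  e : Label → Point
  e (i , true) = tabulate λ c → unit i c
    where
    unit : Fin d → Fin d → Carrier
    unit zero zero = 1#
    unit zero (suc c) = 0#
    unit (suc i) zero = 0#
    unit (suc i) (suc c) = unit' i c
      where
      unit' : ∀ {n} → Fin n → Fin n → Carrier
      unit' zero zero = 1#
      unit' zero (suc _) = 0#
      unit' (suc _) zero = 0#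
      unit' (suc a) (suc b) = unit' a b
  e (i , false) = neg (e (i , true))

  crossVertex : Fin (d ℕ.+ d) → Point
  crossVertex i with splitAt d i
  ... | inj₁ a = e (a , true)
  ... | inj₂ a = e (a , false)

  InP : Point → Set
  InP x = InConv crossVertex All x

  OnBoundary : Point → Set
  OnBoundary x = InP x × (∀ ε → 0# < ε → ∃ λ y →
    (∀ c → (- ε < lookup y c - lookup x c) × (lookup y c - lookup x c < ε)) × ¬ InP y)

  edgeDet : (Fin (suc d) → Point) → Carrier
  edgeDet w = det d (λ r c → lookup (w (suc c)) r - lookup (w zero) r)

  -- A triangulation of P, given by its d-simplices σ j (j < m), each with an
  -- ordering of its vertices v_0,…,v_d for which det[v_1-v_0,…] > 0
  -- (positive orientation; in particular nondegenerate).
  record Triangulation : Set₁ where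
    field
      m : ℕ
      σ : Fin m → Fin (suc d) → Point
      positive : ∀ j → 0# < edgeDet (σ j)
      inside : ∀ j a → InP (σ j a)
      covers : ∀ x → InP x → ∃ λ j → InConv (σ j) All x
      -- face-to-face: the intersection of two simplices is the convex hull
      -- of their common vertices (empty if there are none)
      faceToFace : ∀ j k x → InConv (σ j) All x → InConv (σ k) All x →
        InConv (σ j) (λ a → ∃ λ b → σ k b ≡ σ j a) x
      distinct : ∀ j k → j ≢ k → ∃ λ a → ∀ b → σ k b ≢ σ j a

    BoundaryFace : Fin m → (Fin (suc d) → Set) → Set
    BoundaryFace j S = (∃ λ a → S a) × (∀ x → InConv (σ j) S x → OnBoundary x)

  open Triangulation

  AntipodalOnBoundary : Triangulation → Set₁
  AntipodalOnBoundary T = ∀ j (S : Fin (suc d) → Set) → BoundaryFace T j S →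
    ∃ λ k → Σ (Fin (suc d) → Set) λ S′ →
        (∀ a → S a → ∃ λ b → S′ b × σ T k b ≡ neg (σ T j a))
      × (∀ b → S′ b → ∃ λ a → S a × σ T k b ≡ neg (σ T j a))

  -- a labeling of the vertices, given per simplex-vertex slot, consistent
  -- on coinciding vertices
  record TuckerLabeling (T : Triangulation) : Set where
    field
      ℓ : Fin (m T) → Fin (suc d) → Label
      consistent : ∀ j a k b → σ T j a ≡ σ T k b → ℓ j a ≡ ℓ k b
      antipodal : ∀ j a k b → OnBoundary (σ T j a) → σ T k b ≡ neg (σ T j a) →
        ℓ k b ≡ negL (ℓ j a)

  S₁ : (T : Triangulation) → TuckerLabeling T → Carrier
  S₁ T L = ∑ (m T) λ j → (fromℕ (d !) ⁻¹) * edgeDet (λ a → e (ℓ j a))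
    where open TuckerLabeling L

  HasComplementaryEdge : (T : Triangulation) → TuckerLabeling T → Set
  HasComplementaryEdge T L = ∃ λ j → ∃ λ a → ∃ λ b → ℓ j a ≡ negL (ℓ j b)
    where open TuckerLabeling L

  S₁≢0 : (T : Triangulation) → TuckerLabeling T → Set
  S₁≢0 T L = S₁ T L ≢ 0#

-- Each d-simplex has d + 1 vertices but there are only d label indices, so by pigeonhole two of
-- its vertices a < b carry labels ±i with the same i. If the signs differ, ab is a complementary
-- edge. Otherwise Δ(1, ·) sends a and b to the same point, so the edge matrix of the image simplex
-- has a zero or a repeated column and its signed volume vanishes. Hence if no simplex contains a
-- complementary edge, S(1) is a sum of zeros.

module Submission where

open import Defs
open import Level using (0ℓ)
open import Algebra.Bundles using (CommutativeRing)
open import Algebra.Consequences.Propositional using (comm∧idˡ⇒id; comm∧invˡ⇒inv; comm∧distrˡ⇒distr)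
import Algebra.Properties.Ring as RingProperties
import Algebra.Properties.CommutativeSemigroup as CommutativeSemigroupProperties
open import Data.Nat using (ℕ; _≤_)
open import Data.Nat using (zero; suc; _!)
import Data.Nat as ℕ
import Data.Nat.Properties as ℕ
open import Data.Fin using (Fin; zero; suc; punchIn; punchOut; inject₁; toℕ; _<_)
open import Data.Fin.Properties using (_≟_; punchIn-punchOut; toℕ-inject₁; ≤∧≢⇒<; <⇒≢; pigeonhole)
open import Data.Fin.Induction using (<-weakInduction)
open import Data.Vec using (lookup)
open import Data.Bool using (true; false)
open import Data.Product using (∃; ∃₂; _,_; proj₁)
import Data.Product as Product
open import Data.Sum using (_⊎_; inj₁; inj₂)
open import Data.Empty using (⊥-elim)
open import Function using (_∘_; id)
open import Relation.Nullary using (yes; no)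
open import Relation.Binary.PropositionalEquality

module AdjacentSwap where

  adjacentSwap : ∀ {n} → Fin n → Fin (suc n) → Fin (suc n)
  adjacentSwap zero    zero          = suc zero
  adjacentSwap zero    (suc zero)    = zero
  adjacentSwap zero    (suc (suc k)) = suc (suc k)
  adjacentSwap (suc i) zero          = zero
  adjacentSwap (suc i) (suc k)       = suc (adjacentSwap i k)

  adjacentSwap-inject₁ : ∀ {n} (i : Fin n) → adjacentSwap i (inject₁ i) ≡ suc i
  adjacentSwap-inject₁ zero    = refl
  adjacentSwap-inject₁ (suc i) = cong suc (adjacentSwap-inject₁ i)

  adjacentSwap-suc : ∀ {n} (i : Fin n) → adjacentSwap i (suc i) ≡ inject₁ i
  adjacentSwap-suc zero    = refl
  adjacentSwap-suc (suc i) = cong suc (adjacentSwap-suc i)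

  adjacentSwap-fixed : ∀ {n} (i : Fin n) {k} → k ≢ inject₁ i → k ≢ suc i → adjacentSwap i k ≡ k
  adjacentSwap-fixed zero    {zero}        k≢i k≢1+i = ⊥-elim (k≢i refl)
  adjacentSwap-fixed zero    {suc zero}    k≢i k≢1+i = ⊥-elim (k≢1+i refl)
  adjacentSwap-fixed zero    {suc (suc k)} k≢i k≢1+i = refl
  adjacentSwap-fixed (suc i) {zero}        k≢i k≢1+i = refl
  adjacentSwap-fixed (suc i) {suc k}       k≢i k≢1+i =
    cong suc (adjacentSwap-fixed i (k≢i ∘ cong suc) (k≢1+i ∘ cong suc))

  adjacentSwap-punchIn-inject₁ : ∀ {n} (i c : Fin n) →
    adjacentSwap i (punchIn (inject₁ i) c) ≡ punchIn (suc i) c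
  adjacentSwap-punchIn-inject₁ zero    zero    = refl
  adjacentSwap-punchIn-inject₁ zero    (suc c) = refl
  adjacentSwap-punchIn-inject₁ (suc i) zero    = refl
  adjacentSwap-punchIn-inject₁ (suc i) (suc c) = cong suc (adjacentSwap-punchIn-inject₁ i c)

  adjacentSwap-punchIn-suc : ∀ {n} (i c : Fin n) →
    adjacentSwap i (punchIn (suc i) c) ≡ punchIn (inject₁ i) c
  adjacentSwap-punchIn-suc zero    zero    = refl
  adjacentSwap-punchIn-suc zero    (suc c) = refl
  adjacentSwap-punchIn-suc (suc i) zero    = refl
  adjacentSwap-punchIn-suc (suc i) (suc c) = cong suc (adjacentSwap-punchIn-suc i c)

  adjacentSwap-punchIn : ∀ {n} (i : Fin (suc n)) k → k ≢ inject₁ i → k ≢ suc i →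
    ∃ λ (i′ : Fin n) → ∀ c → adjacentSwap i (punchIn k c) ≡ punchIn k (adjacentSwap i′ c)
  adjacentSwap-punchIn zero zero       k≢i k≢1+i = ⊥-elim (k≢i refl)
  adjacentSwap-punchIn zero (suc zero) k≢i k≢1+i = ⊥-elim (k≢1+i refl)
  adjacentSwap-punchIn {suc n} zero (suc (suc k)) k≢i k≢1+i = zero , commute
    where
    commute : ∀ c → adjacentSwap zero (punchIn (suc (suc k)) c) ≡ punchIn (suc (suc k)) (adjacentSwap zero c)
    commute zero          = refl
    commute (suc zero)    = refl
    commute (suc (suc c)) = refl
  adjacentSwap-punchIn (suc i) zero k≢i k≢1+i = i , λ c → refl
  adjacentSwap-punchIn {suc n} (suc i) (suc k) k≢i k≢1+i
    with i′ , commute ← adjacentSwap-punchIn i k (k≢i ∘ cong suc) (k≢1+i ∘ cong suc)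
    = suc i′ , λ { zero → refl ; (suc c) → cong suc (commute c) }

module FieldProperties (F : CompleteOrderedField) where
  open AdjacentSwap using (adjacentSwap)
  open CompleteOrderedField F renaming (_≤_ to _≤ᶠ_)

  commutativeRing : CommutativeRing 0ℓ 0ℓ
  commutativeRing = record
    { isCommutativeRing = record
      { isRing = record
        { +-isAbelianGroup = record
          { isGroup = record
            { isMonoid = record
              { isSemigroup = record
                { isMagma = record { isEquivalence = isEquivalence ; ∙-cong = cong₂ _+_ }
                ; assoc = +-assoc
                }
              ; identity = comm∧idˡ⇒id +-comm +-identityˡ
              }
            ; inverse = comm∧invˡ⇒inv +-comm +-inverseˡ
            ; ⁻¹-cong = cong (-_)
            }
          ; comm = +-comm
          }
        ; *-cong = cong₂ _*_
        ; *-assoc = *-assoc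
        ; *-identity = comm∧idˡ⇒id *-comm *-identityˡ
        ; distrib = comm∧distrˡ⇒distr (cong₂ _+_) *-comm distribˡ
        }
      ; *-comm = *-comm
      }
    }

  open CommutativeRing commutativeRing using (+-commutativeSemigroup; ring)
  open CommutativeRing commutativeRing public using (-‿inverseʳ; zeroˡ; zeroʳ)
  open RingProperties ring public using (-‿involutive; -‿distribˡ-*; -‿distribʳ-*; -‿+-comm; -0#≈0#)
  open CommutativeSemigroupProperties +-commutativeSemigroup public using (x∙yz≈y∙xz)

  x+x≡0⇒x≡0 : ∀ x → x + x ≡ 0# → x ≡ 0#
  x+x≡0⇒x≡0 x x+x≡0 with ≤-total 0# x
  ... | inj₁ 0≤x = ≤-antisym (subst₂ _≤ᶠ_ (+-identityˡ x) x+x≡0 (+-mono-≤ x 0≤x)) 0≤x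
  ... | inj₂ x≤0 = ≤-antisym x≤0 (subst₂ _≤ᶠ_ x+x≡0 (+-identityˡ x) (+-mono-≤ x x≤0))

  x≡-x⇒x≡0 : ∀ x → x ≡ - x → x ≡ 0#
  x≡-x⇒x≡0 x x≡-x = x+x≡0⇒x≡0 x (trans (cong (x +_) x≡-x) (-‿inverseʳ x))

  ∑-cong : ∀ n {f g : Fin n → Carrier} → (∀ i → f i ≡ g i) → ∑ n f ≡ ∑ n g
  ∑-cong zero    f≗g = refl
  ∑-cong (suc n) f≗g = cong₂ _+_ (f≗g zero) (∑-cong n (f≗g ∘ suc))

  ∑-zero : ∀ n {f : Fin n → Carrier} → (∀ i → f i ≡ 0#) → ∑ n f ≡ 0#
  ∑-zero zero    f≗0 = refl
  ∑-zero (suc n) f≗0 = trans (cong₂ _+_ (f≗0 zero) (∑-zero n (f≗0 ∘ suc))) (+-identityˡ 0#)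

  -‿∑ : ∀ n (f : Fin n → Carrier) → ∑ n (λ i → - f i) ≡ - ∑ n f
  -‿∑ zero    f = sym -0#≈0#
  -‿∑ (suc n) f = trans (cong (- f zero +_) (-‿∑ n (f ∘ suc))) (-‿+-comm (f zero) _)

  ∑-adjacentSwap : ∀ n (i : Fin n) (f : Fin (suc n) → Carrier) →
    ∑ (suc n) (f ∘ adjacentSwap i) ≡ ∑ (suc n) f
  ∑-adjacentSwap (suc n) zero    f = x∙yz≈y∙xz (f (suc zero)) (f zero) _
  ∑-adjacentSwap (suc n) (suc i) f = cong (f zero +_) (∑-adjacentSwap n i (f ∘ suc))

  ∑≢0⇒∃ : ∀ n {P : Fin n → Set} (f : Fin n → Carrier) →
    (∀ i → P i ⊎ f i ≡ 0#) → ∑ n f ≢ 0# → ∃ P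
  ∑≢0⇒∃ zero    f P⊎f≡0 ∑≢0 = ⊥-elim (∑≢0 refl)
  ∑≢0⇒∃ (suc n) f P⊎f≡0 ∑≢0 with P⊎f≡0 zero
  ... | inj₁ P0   = zero , P0
  ... | inj₂ f0≡0 = Product.map suc id (∑≢0⇒∃ n (f ∘ suc) (P⊎f≡0 ∘ suc)
    (λ ∑≡0 → ∑≢0 (trans (cong₂ _+_ f0≡0 ∑≡0) (+-identityˡ 0#))))

module Determinant (F : CompleteOrderedField) where
  open CompleteOrderedField F hiding (_≤_; _<_)
  open FieldProperties F
  open AdjacentSwap
  open ≡-Reasoning

  Matrix : ℕ → Set
  Matrix n = Fin n → Fin n → Carrier

  minor : ∀ {n} → Matrix (suc n) → Fin (suc n) → Matrix n
  minor M k r c = M (suc r) (punchIn k c)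

  laplaceTerm : ∀ {n} → Matrix (suc n) → Fin (suc n) → Carrier
  laplaceTerm {n} M k = altSign (toℕ' k) * M zero k * det n (minor M k)

  swapColumns : ∀ {n} → Fin n → Matrix (suc n) → Matrix (suc n)
  swapColumns i M r = M r ∘ adjacentSwap i

  toℕ'-inject₁ : ∀ {n} (i : Fin n) → toℕ' (inject₁ i) ≡ toℕ' i
  toℕ'-inject₁ zero    = refl
  toℕ'-inject₁ (suc i) = cong suc (toℕ'-inject₁ i)

  det-cong : ∀ n {M N : Matrix n} → (∀ r c → M r c ≡ N r c) → det n M ≡ det n N
  det-cong zero    M≗N = refl
  det-cong (suc n) M≗N = ∑-cong (suc n) λ k →
    cong₂ (λ x y → altSign (toℕ' k) * x * y) (M≗N zero k) (det-cong n (λ r c → M≗N (suc r) (punchIn k c)))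

  laplaceTerm-negate : ∀ {n} (M N : Matrix (suc n)) k l → altSign (toℕ' k) ≡ - altSign (toℕ' l) →
    M zero k ≡ N zero l → det n (minor M k) ≡ det n (minor N l) → laplaceTerm M k ≡ - laplaceTerm N l
  laplaceTerm-negate {n} M N k l sign≡ entry≡ minor≡ = begin
    altSign (toℕ' k) * M zero k * det n (minor M k)     ≡⟨ cong₂ _*_ (cong₂ _*_ sign≡ entry≡) minor≡ ⟩
    - altSign (toℕ' l) * N zero l * det n (minor N l)   ≡⟨ cong (_* det n (minor N l)) (-‿distribˡ-* _ _) ⟨
    - (altSign (toℕ' l) * N zero l) * det n (minor N l) ≡⟨ -‿distribˡ-* _ _ ⟨
    - laplaceTerm N l                                   ∎

  det-swapColumns : ∀ n (i : Fin n) (M : Matrix (suc n)) → det (suc n) (swapColumns i M) ≡ - det (suc n) M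
  laplaceTerm-swapColumns : ∀ n (i : Fin n) (M : Matrix (suc n)) k →
    laplaceTerm (swapColumns i M) k ≡ - laplaceTerm M (adjacentSwap i k)

  det-swapColumns n i M = begin
    ∑ (suc n) (laplaceTerm (swapColumns i M))            ≡⟨ ∑-cong (suc n) (laplaceTerm-swapColumns n i M) ⟩
    ∑ (suc n) (λ k → - laplaceTerm M (adjacentSwap i k)) ≡⟨ -‿∑ (suc n) (laplaceTerm M ∘ adjacentSwap i) ⟩
    - ∑ (suc n) (laplaceTerm M ∘ adjacentSwap i)         ≡⟨ cong -_ (∑-adjacentSwap n i (laplaceTerm M)) ⟩
    - det (suc n) M                                      ∎

  laplaceTerm-swapColumns (suc n) i M k with k ≟ inject₁ i | k ≟ suc i
  ... | yes refl | _ = trans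
    (laplaceTerm-negate (swapColumns i M) M (inject₁ i) (suc i)
      (trans (cong altSign (toℕ'-inject₁ i)) (sym (-‿involutive _)))
      (cong (M zero) (adjacentSwap-inject₁ i))
      (det-cong (suc n) λ r c → cong (M (suc r)) (adjacentSwap-punchIn-inject₁ i c)))
    (cong (-_ ∘ laplaceTerm M) (sym (adjacentSwap-inject₁ i)))
  ... | no _ | yes refl = trans
    (laplaceTerm-negate (swapColumns i M) M (suc i) (inject₁ i)
      (cong (-_ ∘ altSign) (sym (toℕ'-inject₁ i)))
      (cong (M zero) (adjacentSwap-suc i))
      (det-cong (suc n) λ r c → cong (M (suc r)) (adjacentSwap-punchIn-suc i c)))
    (cong (-_ ∘ laplaceTerm M) (sym (adjacentSwap-suc i)))
  ... | no k≢i | no k≢1+i with i′ , commute ← adjacentSwap-punchIn i k k≢i k≢1+i = begin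
    altSign (toℕ' k) * M zero (adjacentSwap i k) * det (suc n) (minor (swapColumns i M) k)
      ≡⟨ cong₂ (λ x y → altSign (toℕ' k) * M zero x * y) (adjacentSwap-fixed i k≢i k≢1+i)
           (det-cong (suc n) λ r c → cong (M (suc r)) (commute c)) ⟩
    altSign (toℕ' k) * M zero k * det (suc n) (swapColumns i′ (minor M k))
      ≡⟨ cong (altSign (toℕ' k) * M zero k *_) (det-swapColumns n i′ (minor M k)) ⟩
    altSign (toℕ' k) * M zero k * - det (suc n) (minor M k)
      ≡⟨ -‿distribʳ-* _ _ ⟨
    - laplaceTerm M k
      ≡⟨ cong (-_ ∘ laplaceTerm M) (adjacentSwap-fixed i k≢i k≢1+i) ⟨
    - laplaceTerm M (adjacentSwap i k) ∎

  det-adjacentEqualColumns : ∀ n (i : Fin n) (M : Matrix (suc n)) →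
    (∀ r → M r (inject₁ i) ≡ M r (suc i)) → det (suc n) M ≡ 0#
  det-adjacentEqualColumns n i M columns≡ =
    x≡-x⇒x≡0 _ (trans (det-cong (suc n) M≗swapped) (det-swapColumns n i M))
    where
    M≗swapped : ∀ r c → M r c ≡ swapColumns i M r c
    M≗swapped r c with c ≟ inject₁ i | c ≟ suc i
    ... | yes refl | _        = trans (columns≡ r) (cong (M r) (sym (adjacentSwap-inject₁ i)))
    ... | no _     | yes refl = trans (sym (columns≡ r)) (cong (M r) (sym (adjacentSwap-suc i)))
    ... | no c≢i   | no c≢1+i = cong (M r) (sym (adjacentSwap-fixed i c≢i c≢1+i))

  -- Induction on q: a swap moves column q down to q - 1, next to p, at the cost of a sign.
  det-equalColumns : ∀ {n} (M : Matrix n) {p q : Fin n} → p < q → (∀ r → M r p ≡ M r q) → det n M ≡ 0#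
  det-equalColumns {suc n} M {q = q} = <-weakInduction EqualColumnsVanish (λ _ ()) step q M
    where
    EqualColumnsVanish : Fin (suc n) → Set
    EqualColumnsVanish q = ∀ (M : Matrix (suc n)) {p} → p < q → (∀ r → M r p ≡ M r q) → det (suc n) M ≡ 0#

    step : ∀ i → EqualColumnsVanish (inject₁ i) → EqualColumnsVanish (suc i)
    step i below M {p} p<1+i columns≡ with p ≟ inject₁ i
    ... | yes refl = det-adjacentEqualColumns n i M columns≡
    ... | no p≢i   = begin
      det (suc n) M                   ≡⟨ -‿involutive _ ⟨
      - - det (suc n) M               ≡⟨ cong -_ (det-swapColumns n i M) ⟨
      - det (suc n) (swapColumns i M) ≡⟨ cong -_ (below (swapColumns i M) p<i swappedColumns≡) ⟩
      - 0#                            ≡⟨ -0#≈0# ⟩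
      0#                              ∎
      where
      p<i : p < inject₁ i
      p<i = ≤∧≢⇒< (subst (toℕ p ℕ.≤_) (sym (toℕ-inject₁ i)) (ℕ.s≤s⁻¹ p<1+i)) p≢i
      swappedColumns≡ : ∀ r → swapColumns i M r p ≡ swapColumns i M r (inject₁ i)
      swappedColumns≡ r = begin
        M r (adjacentSwap i p)           ≡⟨ cong (M r) (adjacentSwap-fixed i p≢i (<⇒≢ p<1+i)) ⟩
        M r p                            ≡⟨ columns≡ r ⟩
        M r (suc i)                      ≡⟨ cong (M r) (adjacentSwap-inject₁ i) ⟨
        M r (adjacentSwap i (inject₁ i)) ∎

  det-zeroColumn : ∀ {n} (M : Matrix n) p → (∀ r → M r p ≡ 0#) → det n M ≡ 0#
  det-zeroColumn {suc n} M p column≡0 = ∑-zero (suc n) laplaceTerm≡0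
    where
    laplaceTerm≡0 : ∀ k → laplaceTerm M k ≡ 0#
    laplaceTerm≡0 k with k ≟ p
    ... | yes refl = begin
      altSign (toℕ' k) * M zero k * det n (minor M k)
        ≡⟨ cong (λ x → altSign (toℕ' k) * x * det n (minor M k)) (column≡0 zero) ⟩
      altSign (toℕ' k) * 0# * det n (minor M k)
        ≡⟨ cong (_* det n (minor M k)) (zeroʳ _) ⟩
      0# * det n (minor M k)
        ≡⟨ zeroˡ _ ⟩
      0# ∎
    ... | no k≢p = begin
      altSign (toℕ' k) * M zero k * det n (minor M k)
        ≡⟨ cong (altSign (toℕ' k) * M zero k *_) (det-zeroColumn (minor M k) (punchOut k≢p) minorColumn≡0) ⟩
      altSign (toℕ' k) * M zero k * 0#
        ≡⟨ zeroʳ _ ⟩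
      0# ∎
      where
      minorColumn≡0 : ∀ r → minor M k r (punchOut k≢p) ≡ 0#
      minorColumn≡0 r = trans (cong (M (suc r)) (punchIn-punchOut k≢p)) (column≡0 (suc r))

module CrossPolytope (F : CompleteOrderedField) (d : ℕ) where
  open CompleteOrderedField F hiding (_≤_; _<_)
  open FieldProperties F
  open Determinant F
  open Geometry F d
  open Triangulation using (m)

  edgeDet-repeatedVertex : (w : Fin (suc d) → Point) {a b : Fin (suc d)} → a < b → w a ≡ w b → edgeDet w ≡ 0#
  edgeDet-repeatedVertex w {zero}  {suc c}  _    w₀≡wc   = det-zeroColumn _ c λ r →
    trans (cong (λ v → lookup v r - lookup (w zero) r) (sym w₀≡wc)) (-‿inverseʳ _)
  edgeDet-repeatedVertex w {suc c} {suc c′} c<c′ wc≡wc′ = det-equalColumns _ (ℕ.s<s⁻¹ c<c′) λ r →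
    cong (λ v → lookup v r - lookup (w zero) r) wc≡wc′

  sameIndex⇒equal⊎opposite : ∀ (x y : Label) → proj₁ x ≡ proj₁ y → x ≡ y ⊎ x ≡ negL y
  sameIndex⇒equal⊎opposite (i , true)  (.i , true)  refl = inj₁ refl
  sameIndex⇒equal⊎opposite (i , true)  (.i , false) refl = inj₂ refl
  sameIndex⇒equal⊎opposite (i , false) (.i , true)  refl = inj₂ refl
  sameIndex⇒equal⊎opposite (i , false) (.i , false) refl = inj₁ refl

  module _ (T : Triangulation) (L : TuckerLabeling T) where
    open TuckerLabeling L

    ComplementaryEdgeIn : Fin (m T) → Set
    ComplementaryEdgeIn j = ∃₂ λ a b → ℓ j a ≡ negL (ℓ j b)

    imageVolume : Fin (m T) → Carrier
    imageVolume j = (fromℕ (d !) ⁻¹) * edgeDet (e ∘ ℓ j)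

    complementaryEdge⊎imageVolume≡0 : ∀ j → ComplementaryEdgeIn j ⊎ imageVolume j ≡ 0#
    complementaryEdge⊎imageVolume≡0 j
      with a , b , a<b , index≡ ← pigeonhole (ℕ.n<1+n d) (proj₁ ∘ ℓ j)
      with sameIndex⇒equal⊎opposite (ℓ j a) (ℓ j b) index≡
    ... | inj₂ opposite = inj₁ (a , b , opposite)
    ... | inj₁ equal    = inj₂ (begin
      (fromℕ (d !) ⁻¹) * edgeDet (e ∘ ℓ j) ≡⟨ cong (_ *_) (edgeDet-repeatedVertex (e ∘ ℓ j) a<b (cong e equal)) ⟩
      (fromℕ (d !) ⁻¹) * 0#                ≡⟨ zeroʳ _ ⟩
      0#                                   ∎)
      where open ≡-Reasoning

proposition3 : (F : CompleteOrderedField) (d : ℕ) → 1 ≤ d →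
    (T : Geometry.Triangulation F d) → Geometry.AntipodalOnBoundary F d T →
    (L : Geometry.TuckerLabeling F d T) → Geometry.S₁≢0 F d T L →
    Geometry.HasComplementaryEdge F d T L
proposition3 F d _ T _ L S₁≢0 =
  ∑≢0⇒∃ (Triangulation.m T) (imageVolume T L) (complementaryEdge⊎imageVolume≡0 T L) S₁≢0
  where
  open FieldProperties F
  open CrossPolytope F d
  open Geometry F d using (Triangulation)
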